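{- Let $\lambda\geq 2$. Suppose there exists an $(n,m,k,\lambda)$-strong external difference family (in some additive abelian group of order $n$) with $m\geq 3$ and $k\geq \lambda+1$. Then \[ \frac{\lambda(k-1)(m-2)}{(\lambda-1)k(m-1)}\leq 1. \]
   Context: For disjoint subsets $A,B$ of an additive abelian group $G$, let $\mathcal{D}(A,B)$ denote the multiset $\{x-y : x\in A,\ y\in B\}$. An $(n,m,k,\lambda)$-strong external difference family (SEDF) in an additive abelian group $G$ of order $n$ is a set of $m\geq 2$ pairwise disjoint $k$-subsets $A_1,\dots,A_m$ of $G$ such that for every $i$, $1\le i\le m$, the multiset union $\bigcup_{j\neq i}\mathcal{D}(A_i,A_j)$ equals $\lambda(G\setminus\{0\})$, i.e. contains every nonzero element of $G$ exactly $\lambda$ times. -}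

module Defs where

open import Level using (0ℓ)
open import Data.Nat using (ℕ)
open import Data.Fin using (Fin; _≟_)
open import Data.Fin.Subset using (Subset; _∈_; ∣_∣; Empty; _∩_)
open import Data.Fin.Subset.Properties using (_∈?_)
open import Data.List using (List; length; filter; map; cartesianProduct; allFin)
open import Data.Nat.ListAction using (sum)
open import Data.Product using (_×_; _,_; proj₁; proj₂)
open import Relation.Nullary using (¬_; _×-dec_; ¬?)
open import Relation.Binary.PropositionalEquality using (_≡_)
open import Algebra.Structures using (IsAbelianGroup)

-- An additive abelian group of order n, presented (up to isomorphism) as an
-- abelian group structure on the carrier Fin n with propositional equality.
record FinAbGroup (n : ℕ) : Set where
  field
    _+_ : Fin n → Fin n → Fin n
    0#  : Fin n
    -_  : Fin n → Fin n
    isAbelianGroup : IsAbelianGroup _≡_ _+_ 0# -_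

  _-_ : Fin n → Fin n → Fin n
  x - y = x + (- y)

module _ {n : ℕ} (G : FinAbGroup n) where
  open FinAbGroup G

  diffCount : Subset n → Subset n → Fin n → ℕ
  diffCount A B g =
    length (filter (λ p → (proj₁ p ∈? A) ×-dec ((proj₂ p ∈? B) ×-dec (proj₁ p - proj₂ p ≟ g)))
                   (cartesianProduct (allFin n) (allFin n)))

  IsSEDF : (m k lam : ℕ) → (Fin m → Subset n) → Set
  IsSEDF m k lam A =
    (2 Data.Nat.≤ m)
    × (∀ i → ∣ A i ∣ ≡ k)
    × (∀ i j → ¬ i ≡ j → Empty (A i ∩ A j))
    × (∀ i (g : Fin n) → ¬ g ≡ 0# →
         sum (map (λ j → diffCount (A i) (A j) g) (filter (λ j → ¬? (j ≟ i)) (allFin m))) ≡ lam)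

-- Fix a block A i. Let b count membership in the other blocks and let ρ g be the
-- number of ways to write g = x - y with x ∈ A i and y in another block. The SEDF
-- condition and disjointness say ρ = λ away from 0 and ρ 0 = 0, so
-- ∑ ρ² = λ ∑ ρ = λ k (m - 1) k. On the other hand ∑ ρ² = ∑_{x,x′ ∈ A i} T (x - x′),
-- where T d counts the representations d = y - y′ inside the other blocks:
-- T 0 ≥ (m - 1) k, and for d ≠ 0 the SEDF condition for the other blocks, together with
-- the symmetry D(A j, A i) = - D(A i, A j), gives T d ≥ (m - 2) λ. Hence
-- λ k (m - 1) k ≥ k ((m - 1) k + (k - 1)(m - 2) λ), which rearranges to the claim.

module Submission where

open import Defs
open import Data.Nat using (ℕ; zero; suc; _+_; _≤_; _*_; _∸_; z≤n; s≤s; NonZero; >-nonZero)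
open import Data.Nat.Tactic.RingSolver using (solve-∀)
open import Data.Nat.Properties hiding (_≟_)
open import Data.Fin as Fin using (Fin; _≟_)
open import Data.Fin.Subset using (Subset; _∈_; ∣_∣; inside; outside; Empty; _∩_)
open import Data.Fin.Subset.Properties using (_∈?_; x∈p∩q⁺)
open import Data.Vec using ([]; _∷_)
open import Data.Product using (Σ; _×_; _,_; proj₁; proj₂)
open import Data.Bool using (true; false; if_then_else_)
open import Data.List as List using (List; []; _∷_; _++_; tabulate; allFin; filter; length; cartesianProduct)
open import Data.List.Properties using (map-tabulate; map-++; map-∘)
open import Data.Nat.ListAction as ℕL using ()
open import Data.Nat.ListAction.Properties as ℕL using ()
open import Relation.Nullary using (Dec; yes; no; does; _×-dec_; ¬?; contradiction)
open import Relation.Unary using (Pred; Decidable)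
open import Relation.Binary.PropositionalEquality
open import Level using (0ℓ)
open import Algebra.Bundles using (AbelianGroup)
open import Algebra.Properties.Semiring.Sum +-*-semiring
  using (sum; sum-syntax; sum-cong-≗; sum-replicate-zero; ∑-distrib-+; ∑-comm; *-distribˡ-sum; *-distribʳ-sum)
open import Function using (_∘_; id)
open import Algebra.Properties.CommutativeSemigroup *-commutativeSemigroup using (x∙yz≈y∙xz)


𝟙 : ∀ {p} {P : Set p} → Dec P → ℕ
𝟙 d = if does d then 1 else 0

𝟙-×-dec : ∀ {p q} {P : Set p} {Q : Set q} (P? : Dec P) (Q? : Dec Q) → 𝟙 (P? ×-dec Q?) ≡ 𝟙 P? * 𝟙 Q?
𝟙-×-dec (yes _) (yes _) = refl
𝟙-×-dec (yes _) (no _)  = refl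
𝟙-×-dec (no _)  _       = refl

𝟙≤1 : ∀ {p} {P : Set p} (P? : Dec P) → 𝟙 P? ≤ 1
𝟙≤1 (yes _) = s≤s z≤n
𝟙≤1 (no _)  = z≤n

𝟙-cong : ∀ {p q} {P : Set p} {Q : Set q} → (P → Q) → (Q → P) → (P? : Dec P) (Q? : Dec Q) → 𝟙 P? ≡ 𝟙 Q?
𝟙-cong _   _   (yes _) (yes _) = refl
𝟙-cong _   _   (no _)  (no _)  = refl
𝟙-cong P→Q Q→P (yes p) (no ¬q) = contradiction (P→Q p) ¬q
𝟙-cong P→Q Q→P (no ¬p) (yes q) = contradiction (Q→P q) ¬p

module _ {a} {A : Set a} where

  sum-map-filter : ∀ {p} {P : Pred A p} (P? : Decidable P) (f : A → ℕ) (xs : List A) →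
                   ℕL.sum (List.map f (filter P? xs)) ≡ ℕL.sum (List.map (λ x → 𝟙 (P? x) * f x) xs)
  sum-map-filter P? f [] = refl
  sum-map-filter P? f (x ∷ xs) with does (P? x)
  ... | true  = cong₂ _+_ (sym (+-identityʳ (f x))) (sum-map-filter P? f xs)
  ... | false = sum-map-filter P? f xs

  length-filter≡sum : ∀ {p} {P : Pred A p} (P? : Decidable P) (xs : List A) →
                      length (filter P? xs) ≡ ℕL.sum (List.map (𝟙 ∘ P?) xs)
  length-filter≡sum P? [] = refl
  length-filter≡sum P? (x ∷ xs) with does (P? x)
  ... | true  = cong suc (length-filter≡sum P? xs)
  ... | false = length-filter≡sum P? xs

  sum-map-cartesianProduct : ∀ {b} {B : Set b} (f : A × B → ℕ) (xs : List A) (ys : List B) →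
    ℕL.sum (List.map f (cartesianProduct xs ys)) ≡
    ℕL.sum (List.map (λ x → ℕL.sum (List.map (λ y → f (x , y)) ys)) xs)
  sum-map-cartesianProduct f [] ys = refl
  sum-map-cartesianProduct f (x ∷ xs) ys = begin
    ℕL.sum (List.map f (List.map (x ,_) ys ++ cartesianProduct xs ys))
      ≡⟨ cong ℕL.sum (map-++ f (List.map (x ,_) ys) _) ⟩
    ℕL.sum (List.map f (List.map (x ,_) ys) ++ List.map f (cartesianProduct xs ys))
      ≡⟨ ℕL.sum-++ (List.map f (List.map (x ,_) ys)) _ ⟩
    ℕL.sum (List.map f (List.map (x ,_) ys)) + ℕL.sum (List.map f (cartesianProduct xs ys))
      ≡⟨ cong₂ _+_ (cong ℕL.sum (sym (map-∘ ys))) (sum-map-cartesianProduct f xs ys) ⟩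
    _ ∎
    where open ≡-Reasoning

sum-tabulate : ∀ {n} (f : Fin n → ℕ) → ℕL.sum (tabulate f) ≡ sum f
sum-tabulate {zero}  f = refl
sum-tabulate {suc n} f = cong (f Fin.zero +_) (sum-tabulate (f ∘ Fin.suc))

sum-map-allFin : ∀ {n} (f : Fin n → ℕ) → ℕL.sum (List.map f (allFin n)) ≡ sum f
sum-map-allFin f = trans (cong ℕL.sum (map-tabulate id f)) (sum-tabulate f)

∑-mono-≤ : ∀ {n} {f g : Fin n → ℕ} → (∀ i → f i ≤ g i) → sum f ≤ sum g
∑-mono-≤ {zero}  f≤g = z≤n
∑-mono-≤ {suc n} f≤g = +-mono-≤ (f≤g Fin.zero) (∑-mono-≤ (f≤g ∘ Fin.suc))

∑-const : ∀ n (c : ℕ) → ∑[ i < n ] c ≡ n * c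
∑-const zero    c = refl
∑-const (suc n) c = cong (c +_) (∑-const n c)

*-distribˡ-∑∑ : ∀ {m n} c (f : Fin m → Fin n → ℕ) →
                c * (∑[ i < m ] ∑[ j < n ] f i j) ≡ ∑[ i < m ] ∑[ j < n ] (c * f i j)
*-distribˡ-∑∑ c f = trans (*-distribˡ-sum c (λ i → ∑[ j < _ ] f i j)) (sum-cong-≗ (λ i → *-distribˡ-sum c (f i)))

δ : ∀ {n} → Fin n → Fin n → ℕ
δ a b = 𝟙 (a ≟ b)

-- Written with j ≟ i to match the filter in IsSEDF definitionally.
δ̄ : ∀ {n} → Fin n → Fin n → ℕ
δ̄ i j = 𝟙 (¬? (j ≟ i))

∑-δ : ∀ {n} (a : Fin n) (h : Fin n → ℕ) → ∑[ b < n ] (δ a b * h b) ≡ h a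
∑-δ {suc n} Fin.zero    h =
  trans (cong (1 * h Fin.zero +_) (sum-replicate-zero n)) (trans (+-identityʳ _) (*-identityˡ _))
∑-δ {suc n} (Fin.suc a) h = ∑-δ a (h ∘ Fin.suc)

δ+δ̄≡1 : ∀ {n} (i j : Fin n) → δ i j + δ̄ i j ≡ 1
δ+δ̄≡1 i j with i ≟ j | j ≟ i
... | yes _   | yes _   = refl
... | no _    | no _    = refl
... | yes i≡j | no j≢i  = contradiction (sym i≡j) j≢i
... | no i≢j  | yes j≡i = contradiction (sym j≡i) i≢j

∑-split : ∀ {n} (i : Fin n) (f : Fin n → ℕ) → f i + ∑[ j < n ] (δ̄ i j * f j) ≡ sum f
∑-split {n} i f = begin
  f i + ∑[ j < n ] (δ̄ i j * f j)
    ≡⟨ cong (_+ ∑[ j < n ] (δ̄ i j * f j)) (sym (∑-δ i f)) ⟩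
  ∑[ j < n ] (δ i j * f j) + ∑[ j < n ] (δ̄ i j * f j)
    ≡⟨ sym (∑-distrib-+ (λ j → δ i j * f j) (λ j → δ̄ i j * f j)) ⟩
  ∑[ j < n ] (δ i j * f j + δ̄ i j * f j)
    ≡⟨ sum-cong-≗ (λ j → sym (*-distribʳ-+ (f j) (δ i j) (δ̄ i j))) ⟩
  ∑[ j < n ] ((δ i j + δ̄ i j) * f j)
    ≡⟨ sum-cong-≗ (λ j → trans (cong (_* f j) (δ+δ̄≡1 i j)) (*-identityˡ (f j))) ⟩
  sum f ∎
  where open ≡-Reasoning

∑-δ̄-const : ∀ {n} (i : Fin n) (c : ℕ) → ∑[ j < n ] (δ̄ i j * c) ≡ (n ∸ 1) * c
∑-δ̄-const {n} i c = begin
  ∑[ j < n ] (δ̄ i j * c)                 ≡⟨ sym (m+n∸m≡n c _) ⟩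
  c + ∑[ j < n ] (δ̄ i j * c) ∸ c         ≡⟨ cong (_∸ c) (trans (∑-split i (λ _ → c)) (∑-const n c)) ⟩
  n * c ∸ c                              ≡⟨ cong (n * c ∸_) (sym (*-identityˡ c)) ⟩
  n * c ∸ 1 * c                          ≡⟨ sym (*-distribʳ-∸ c n 1) ⟩
  (n ∸ 1) * c ∎
  where open ≡-Reasoning

χ : ∀ {n} → Subset n → Fin n → ℕ
χ A x = 𝟙 (x ∈? A)

∣A∣≡∑χ : ∀ {n} (A : Subset n) → ∣ A ∣ ≡ sum (χ A)
∣A∣≡∑χ []            = refl
∣A∣≡∑χ (inside ∷ A)  = cong suc (∣A∣≡∑χ A)
∣A∣≡∑χ (outside ∷ A) = ∣A∣≡∑χ A

χ-∈ : ∀ {n} {A : Subset n} {x} → x ∈ A → χ A x ≡ 1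
χ-∈ {A = A} {x} x∈A with x ∈? A
... | yes _   = refl
... | no x∉A  = contradiction x∈A x∉A

∑δ̄χ≡∣A∣∸1 : ∀ {n} (A : Subset n) {x} → x ∈ A → ∑[ x′ < n ] (δ̄ x x′ * χ A x′) ≡ ∣ A ∣ ∸ 1
∑δ̄χ≡∣A∣∸1 {n} A {x} x∈A = begin
  S              ≡⟨ sym (m+n∸m≡n 1 S) ⟩
  1 + S ∸ 1      ≡⟨ cong (λ c → c + S ∸ 1) (sym (χ-∈ x∈A)) ⟩
  χ A x + S ∸ 1  ≡⟨ cong (_∸ 1) (trans (∑-split x (χ A)) (sym (∣A∣≡∑χ A))) ⟩
  ∣ A ∣ ∸ 1 ∎
  where
  open ≡-Reasoning
  S : ℕ
  S = ∑[ x′ < n ] (δ̄ x x′ * χ A x′)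

∑∑χχ-lower-bound : ∀ {n} (A : Subset n) (T : Fin n → Fin n → ℕ) {t₀ t₁ : ℕ} →
  (∀ x → t₀ ≤ T x x) → (∀ x x′ → x′ ≢ x → t₁ ≤ T x x′) →
  ∣ A ∣ * (t₀ + (∣ A ∣ ∸ 1) * t₁) ≤ ∑[ x < n ] ∑[ x′ < n ] (χ A x * (χ A x′ * T x x′))
∑∑χχ-lower-bound {n} A T {t₀} {t₁} diag off = begin
  ∣ A ∣ * c                                        ≡⟨ cong (_* c) (∣A∣≡∑χ A) ⟩
  sum (χ A) * c                                    ≡⟨ *-distribʳ-sum c (χ A) ⟩
  ∑[ x < n ] (χ A x * c)                           ≤⟨ ∑-mono-≤ per-row ⟩
  ∑[ x < n ] (χ A x * row x)                       ≡⟨ sum-cong-≗ (λ x → *-distribˡ-sum (χ A x) (λ x′ → χ A x′ * T x x′)) ⟩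
  ∑[ x < n ] ∑[ x′ < n ] (χ A x * (χ A x′ * T x x′)) ∎
  where
  open ≤-Reasoning
  c : ℕ
  c = t₀ + (∣ A ∣ ∸ 1) * t₁
  row : Fin n → ℕ
  row x = ∑[ x′ < n ] (χ A x′ * T x x′)
  off-diagonal : ∀ x x′ → δ̄ x x′ * (χ A x′ * t₁) ≤ δ̄ x x′ * (χ A x′ * T x x′)
  off-diagonal x x′ with x′ ≟ x
  ... | yes _    = z≤n
  ... | no x′≢x  = *-monoʳ-≤ 1 (*-monoʳ-≤ (χ A x′) (off x x′ x′≢x))
  row-bound : ∀ x → x ∈ A → c ≤ row x
  row-bound x x∈A = begin
    t₀ + (∣ A ∣ ∸ 1) * t₁                             ≡⟨ cong (λ k → t₀ + k * t₁) (sym (∑δ̄χ≡∣A∣∸1 A x∈A)) ⟩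
    t₀ + ∑[ x′ < n ] (δ̄ x x′ * χ A x′) * t₁           ≡⟨ cong (t₀ +_) (*-distribʳ-sum t₁ (λ x′ → δ̄ x x′ * χ A x′)) ⟩
    t₀ + ∑[ x′ < n ] (δ̄ x x′ * χ A x′ * t₁)           ≡⟨ cong (t₀ +_) (sum-cong-≗ (λ x′ → *-assoc (δ̄ x x′) (χ A x′) t₁)) ⟩
    t₀ + ∑[ x′ < n ] (δ̄ x x′ * (χ A x′ * t₁))         ≤⟨ +-mono-≤ diagonal (∑-mono-≤ (off-diagonal x)) ⟩
    χ A x * T x x + ∑[ x′ < n ] (δ̄ x x′ * (χ A x′ * T x x′)) ≡⟨ ∑-split x (λ x′ → χ A x′ * T x x′) ⟩
    row x ∎
    where
    diagonal : t₀ ≤ χ A x * T x x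
    diagonal = ≤-trans (diag x) (≤-reflexive (sym (trans (cong (_* T x x) (χ-∈ x∈A)) (*-identityˡ (T x x)))))
  per-row : ∀ x → χ A x * c ≤ χ A x * row x
  per-row x with x ∈? A
  ... | yes x∈A = *-monoʳ-≤ 1 (row-bound x x∈A)
  ... | no _    = z≤n

module FinAbGroupProperties {n : ℕ} (G : FinAbGroup n) where

  open FinAbGroup G renaming (_+_ to _∙_)
  open ≡-Reasoning

  abelianGroup : AbelianGroup 0ℓ 0ℓ
  abelianGroup = record { isAbelianGroup = isAbelianGroup }

  open AbelianGroup abelianGroup using (assoc; comm; identityˡ; inverseˡ; inverseʳ)
  open import Algebra.Properties.AbelianGroup abelianGroup
    using (x∙y⁻¹≈ε⇒x≈y; ⁻¹-anti-homo‿-; ⁻¹-involutive; ε⁻¹≈ε)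

  x-y≡0⇒x≡y : ∀ {x y} → x - y ≡ 0# → x ≡ y
  x-y≡0⇒x≡y = x∙y⁻¹≈ε⇒x≈y _ _

  -‿involutive : ∀ x → - (- x) ≡ x
  -‿involutive = ⁻¹-involutive

  x-x≡0 : ∀ x → x - x ≡ 0#
  x-x≡0 = inverseʳ

  -‿≢0 : ∀ {d} → d ≢ 0# → - d ≢ 0#
  -‿≢0 d≢0 -d≡0 = d≢0 (trans (sym (-‿involutive _)) (trans (cong -_ -d≡0) ε⁻¹≈ε))

  -‿flip : ∀ x y → - (x - y) ≡ y - x
  -‿flip = ⁻¹-anti-homo‿-

  x-y≡d⇒y-x≡-d : ∀ {x y d} → x - y ≡ d → y - x ≡ - d
  x-y≡d⇒y-x≡-d {x} {y} x-y≡d = trans (sym (-‿flip x y)) (cong -_ x-y≡d)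

  y-x≡-d⇒x-y≡d : ∀ {x y d} → y - x ≡ - d → x - y ≡ d
  y-x≡-d⇒x-y≡d {x} {y} y-x≡-d = trans (sym (-‿flip y x)) (trans (cong -_ y-x≡-d) (-‿involutive _))

  telescope : ∀ x y z → (x - y) ∙ (y - z) ≡ x - z
  telescope x y z = begin
    (x - y) ∙ (y - z)            ≡⟨ assoc x (- y) (y - z) ⟩
    x ∙ ((- y) ∙ (y - z))        ≡⟨ cong (x ∙_) (sym (assoc (- y) y (- z))) ⟩
    x ∙ (((- y) ∙ y) ∙ (- z))    ≡⟨ cong (λ u → x ∙ (u ∙ (- z))) (inverseˡ y) ⟩
    x ∙ (0# ∙ (- z))             ≡⟨ cong (x ∙_) (identityˡ (- z)) ⟩
    x - z ∎

  -‿exchange : ∀ {a b c d} → a - b ≡ c - d → a - c ≡ b - d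
  -‿exchange {a} {b} {c} {d} a-b≡c-d = begin
    a - c              ≡⟨ sym (telescope a b c) ⟩
    (a - b) ∙ (b - c)  ≡⟨ cong (_∙ (b - c)) a-b≡c-d ⟩
    (c - d) ∙ (b - c)  ≡⟨ comm (c - d) (b - c) ⟩
    (b - c) ∙ (c - d)  ≡⟨ telescope b c d ⟩
    b - d ∎

module DifferenceConvolution {n : ℕ} (G : FinAbGroup n) where

  open FinAbGroup G renaming (_+_ to _∙_)
  open FinAbGroupProperties G
  open ≡-Reasoning

  Δ : (Fin n → ℕ) → (Fin n → ℕ) → Fin n → ℕ
  Δ u v g = ∑[ x < n ] ∑[ y < n ] (u x * (v y * δ (x - y) g))

  Δ-pairing : ∀ u v h → ∑[ g < n ] (Δ u v g * h g) ≡ ∑[ x < n ] ∑[ y < n ] (u x * (v y * h (x - y)))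
  Δ-pairing u v h = begin
    ∑[ g < n ] (Δ u v g * h g)
      ≡⟨ sum-cong-≗ (λ g → trans (*-distribʳ-sum (h g) (λ x → ∑[ y < n ] t g x y))
                                 (sum-cong-≗ (λ x → *-distribʳ-sum (h g) (t g x)))) ⟩
    ∑[ g < n ] ∑[ x < n ] ∑[ y < n ] (t g x y * h g)
      ≡⟨ ∑-comm (λ g x → ∑[ y < n ] (t g x y * h g)) ⟩
    ∑[ x < n ] ∑[ g < n ] ∑[ y < n ] (t g x y * h g)
      ≡⟨ sum-cong-≗ (λ x → ∑-comm (λ g y → t g x y * h g)) ⟩
    ∑[ x < n ] ∑[ y < n ] ∑[ g < n ] (t g x y * h g)
      ≡⟨ sum-cong-≗ (λ x → sum-cong-≗ (λ y → pull (u x) (v y) (λ g → δ (x - y) g) h)) ⟩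
    ∑[ x < n ] ∑[ y < n ] (u x * (v y * ∑[ g < n ] (δ (x - y) g * h g)))
      ≡⟨ sum-cong-≗ (λ x → sum-cong-≗ (λ y → cong (λ s → u x * (v y * s)) (∑-δ (x - y) h))) ⟩
    ∑[ x < n ] ∑[ y < n ] (u x * (v y * h (x - y))) ∎
    where
    t : Fin n → Fin n → Fin n → ℕ
    t g x y = u x * (v y * δ (x - y) g)
    pull : ∀ a b (e h : Fin n → ℕ) → ∑[ g < n ] (a * (b * e g) * h g) ≡ a * (b * ∑[ g < n ] (e g * h g))
    pull a b e h = begin
      ∑[ g < n ] (a * (b * e g) * h g)
        ≡⟨ sum-cong-≗ (λ g → trans (*-assoc a (b * e g) (h g)) (cong (a *_) (*-assoc b (e g) (h g)))) ⟩
      ∑[ g < n ] (a * (b * (e g * h g))) ≡⟨ sym (*-distribˡ-sum a (λ g → b * (e g * h g))) ⟩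
      a * ∑[ g < n ] (b * (e g * h g))   ≡⟨ cong (a *_) (sym (*-distribˡ-sum b (λ g → e g * h g))) ⟩
      a * (b * ∑[ g < n ] (e g * h g)) ∎

  Δ-sum : ∀ u v → ∑[ g < n ] Δ u v g ≡ sum u * sum v
  Δ-sum u v = begin
    ∑[ g < n ] Δ u v g                          ≡⟨ sum-cong-≗ (λ g → sym (*-identityʳ (Δ u v g))) ⟩
    ∑[ g < n ] (Δ u v g * 1)                    ≡⟨ Δ-pairing u v (λ _ → 1) ⟩
    ∑[ x < n ] ∑[ y < n ] (u x * (v y * 1))     ≡⟨ sum-cong-≗ (λ x → sum-cong-≗ (λ y → cong (u x *_) (*-identityʳ (v y)))) ⟩
    ∑[ x < n ] ∑[ y < n ] (u x * v y)           ≡⟨ sum-cong-≗ (λ x → sym (*-distribˡ-sum (u x) v)) ⟩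
    ∑[ x < n ] (u x * sum v)                    ≡⟨ sym (*-distribʳ-sum (sum v) u) ⟩
    sum u * sum v ∎

  Δ-sq : ∀ u v → ∑[ g < n ] (Δ u v g * Δ u v g) ≡ ∑[ x < n ] ∑[ x′ < n ] (u x * (u x′ * Δ v v (x - x′)))
  Δ-sq u v = trans (Δ-pairing u v (Δ u v)) (sum-cong-≗ λ x →
    trans (sym (*-distribˡ-sum (u x) (λ y → v y * Δ u v (x - y))))
          (trans (cong (u x *_) (inner x)) (*-distribˡ-sum (u x) (λ x′ → u x′ * Δ v v (x - x′)))))
    where
    δ-exchange : ∀ x x′ y y′ → δ (x′ - y′) (x - y) ≡ δ (y - y′) (x - x′)
    δ-exchange x x′ y y′ = 𝟙-cong (λ e → sym (-‿exchange (sym e))) (λ e → sym (-‿exchange (sym e)))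
                             ((x′ - y′) ≟ (x - y)) ((y - y′) ≟ (x - x′))
    inner : ∀ x → ∑[ y < n ] (v y * Δ u v (x - y)) ≡ ∑[ x′ < n ] (u x′ * Δ v v (x - x′))
    inner x = begin
      ∑[ y < n ] (v y * Δ u v (x - y))
        ≡⟨ sum-cong-≗ (λ y → *-distribˡ-∑∑ (v y) (λ x′ y′ → u x′ * (v y′ * δ (x′ - y′) (x - y)))) ⟩
      ∑[ y < n ] ∑[ x′ < n ] ∑[ y′ < n ] (v y * (u x′ * (v y′ * δ (x′ - y′) (x - y))))
        ≡⟨ ∑-comm (λ y x′ → ∑[ y′ < n ] (v y * (u x′ * (v y′ * δ (x′ - y′) (x - y))))) ⟩
      ∑[ x′ < n ] ∑[ y < n ] ∑[ y′ < n ] (v y * (u x′ * (v y′ * δ (x′ - y′) (x - y))))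
        ≡⟨ sum-cong-≗ (λ x′ → sum-cong-≗ (λ y → sum-cong-≗ (λ y′ →
             trans (x∙yz≈y∙xz (v y) (u x′) _) (cong (λ e → u x′ * (v y * (v y′ * e))) (δ-exchange x x′ y y′))))) ⟩
      ∑[ x′ < n ] ∑[ y < n ] ∑[ y′ < n ] (u x′ * (v y * (v y′ * δ (y - y′) (x - x′))))
        ≡⟨ sum-cong-≗ (λ x′ → sym (*-distribˡ-∑∑ (u x′) (λ y y′ → v y * (v y′ * δ (y - y′) (x - x′))))) ⟩
      ∑[ x′ < n ] (u x′ * Δ v v (x - x′)) ∎

  Δ-swap : ∀ u v d → Δ u v d ≡ Δ v u (- d)
  Δ-swap u v d = trans (∑-comm (λ x y → u x * (v y * δ (x - y) d)))
    (sum-cong-≗ λ y → sum-cong-≗ λ x →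
      trans (x∙yz≈y∙xz (u x) (v y) _) (cong (λ e → v y * (u x * e)) (δ-flip x y)))
    where
    δ-flip : ∀ x y → δ (x - y) d ≡ δ (y - x) (- d)
    δ-flip x y = 𝟙-cong x-y≡d⇒y-x≡-d y-x≡-d⇒x-y≡d ((x - y) ≟ d) ((y - x) ≟ (- d))

  Δ-at-0 : ∀ u v → Δ u v 0# ≡ ∑[ x < n ] (u x * v x)
  Δ-at-0 u v = sum-cong-≗ λ x → begin
    ∑[ y < n ] (u x * (v y * δ (x - y) 0#))
      ≡⟨ sum-cong-≗ (λ y → cong (u x *_) (trans (*-comm (v y) _) (cong (_* v y) (δ-0 x y)))) ⟩
    ∑[ y < n ] (u x * (δ x y * v y))        ≡⟨ sym (*-distribˡ-sum (u x) (λ y → δ x y * v y)) ⟩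
    u x * ∑[ y < n ] (δ x y * v y)          ≡⟨ cong (u x *_) (∑-δ x v) ⟩
    u x * v x ∎
    where
    δ-0 : ∀ x y → δ (x - y) 0# ≡ δ x y
    δ-0 x y = 𝟙-cong x-y≡0⇒x≡y (λ { refl → x-x≡0 x }) ((x - y) ≟ 0#) (x ≟ y)

  Δ-linearˡ : ∀ {m} (w : Fin m → ℕ) (f : Fin m → Fin n → ℕ) v d →
              Δ (λ x → ∑[ j < m ] (w j * f j x)) v d ≡ ∑[ j < m ] (w j * Δ (f j) v d)
  Δ-linearˡ {m} w f v d = begin
    Δ (λ x → ∑[ j < m ] (w j * f j x)) v d
      ≡⟨ sum-cong-≗ (λ x → sum-cong-≗ (λ y → *-distribʳ-sum (v y * δ (x - y) d) (λ j → w j * f j x))) ⟩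
    ∑[ x < n ] ∑[ y < n ] ∑[ j < m ] (w j * f j x * (v y * δ (x - y) d))
      ≡⟨ sum-cong-≗ (λ x → ∑-comm (λ y j → w j * f j x * (v y * δ (x - y) d))) ⟩
    ∑[ x < n ] ∑[ j < m ] ∑[ y < n ] (w j * f j x * (v y * δ (x - y) d))
      ≡⟨ ∑-comm (λ x j → ∑[ y < n ] (w j * f j x * (v y * δ (x - y) d))) ⟩
    ∑[ j < m ] ∑[ x < n ] ∑[ y < n ] (w j * f j x * (v y * δ (x - y) d))
      ≡⟨ sum-cong-≗ (λ j → trans (sum-cong-≗ (λ x → sum-cong-≗ (λ y → *-assoc (w j) (f j x) (v y * δ (x - y) d))))
                                 (sym (*-distribˡ-∑∑ (w j) (λ x y → f j x * (v y * δ (x - y) d))))) ⟩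
    ∑[ j < m ] (w j * Δ (f j) v d) ∎

  Δ-linearʳ : ∀ {m} u (w : Fin m → ℕ) (f : Fin m → Fin n → ℕ) d →
              Δ u (λ y → ∑[ j < m ] (w j * f j y)) d ≡ ∑[ j < m ] (w j * Δ u (f j) d)
  Δ-linearʳ {m} u w f d = begin
    Δ u (λ y → ∑[ j < m ] (w j * f j y)) d   ≡⟨ Δ-swap u (λ y → ∑[ j < m ] (w j * f j y)) d ⟩
    Δ (λ y → ∑[ j < m ] (w j * f j y)) u (- d) ≡⟨ Δ-linearˡ w f u (- d) ⟩
    ∑[ j < m ] (w j * Δ (f j) u (- d))       ≡⟨ sum-cong-≗ (λ j → cong (w j *_) (Δ-swap (f j) u (- d))) ⟩
    ∑[ j < m ] (w j * Δ u (f j) (- (- d)))   ≡⟨ sum-cong-≗ (λ j → cong (λ e → w j * Δ u (f j) e) (-‿involutive d)) ⟩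
    ∑[ j < m ] (w j * Δ u (f j) d) ∎

  diffCount≡Δ : ∀ A B g → diffCount G A B g ≡ Δ (χ A) (χ B) g
  diffCount≡Δ A B g = begin
    length (filter P? (cartesianProduct (allFin n) (allFin n)))
      ≡⟨ length-filter≡sum P? (cartesianProduct (allFin n) (allFin n)) ⟩
    ℕL.sum (List.map (𝟙 ∘ P?) (cartesianProduct (allFin n) (allFin n)))
      ≡⟨ sum-map-cartesianProduct (𝟙 ∘ P?) (allFin n) (allFin n) ⟩
    ℕL.sum (List.map (λ x → ℕL.sum (List.map (λ y → 𝟙 (P? (x , y))) (allFin n))) (allFin n))
      ≡⟨ sum-map-allFin (λ x → ℕL.sum (List.map (λ y → 𝟙 (P? (x , y))) (allFin n))) ⟩
    ∑[ x < n ] ℕL.sum (List.map (λ y → 𝟙 (P? (x , y))) (allFin n))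
      ≡⟨ sum-cong-≗ (λ x → sum-map-allFin (λ y → 𝟙 (P? (x , y)))) ⟩
    ∑[ x < n ] ∑[ y < n ] 𝟙 (P? (x , y))
      ≡⟨ sum-cong-≗ (λ x → sum-cong-≗ (λ y → 𝟙-P? x y)) ⟩
    Δ (χ A) (χ B) g ∎
    where
    P? = λ (p : Fin n × Fin n) → (proj₁ p ∈? A) ×-dec ((proj₂ p ∈? B) ×-dec (proj₁ p - proj₂ p ≟ g))
    𝟙-P? : ∀ x y → 𝟙 (P? (x , y)) ≡ χ A x * (χ B y * δ (x - y) g)
    𝟙-P? x y = trans (𝟙-×-dec (x ∈? A) ((y ∈? B) ×-dec ((x - y) ≟ g)))
                     (cong (χ A x *_) (𝟙-×-dec (y ∈? B) ((x - y) ≟ g)))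

module SEDFCounting {n m k lam : ℕ} (G : FinAbGroup n) (A : Fin m → Subset n)
  (sizes    : ∀ j → ∣ A j ∣ ≡ k)
  (disjoint : ∀ j l → j ≢ l → Empty (A j ∩ A l))
  (balanced : ∀ j (g : Fin n) → g ≢ FinAbGroup.0# G →
              ℕL.sum (List.map (λ l → diffCount G (A j) (A l) g) (filter (λ l → ¬? (l ≟ j)) (allFin m))) ≡ lam)
  where

  open FinAbGroup G renaming (_+_ to _∙_)
  open FinAbGroupProperties G
  open DifferenceConvolution G

  C : Fin m → Fin m → Fin n → ℕ
  C j l = Δ (χ (A j)) (χ (A l))

  ∑C≡λ : ∀ j d → d ≢ 0# → ∑[ l < m ] (δ̄ j l * C j l d) ≡ lam
  ∑C≡λ j d d≢0 = begin
    ∑[ l < m ] (δ̄ j l * C j l d)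
      ≡⟨ sum-cong-≗ (λ l → cong (δ̄ j l *_) (sym (diffCount≡Δ (A j) (A l) d))) ⟩
    ∑[ l < m ] (δ̄ j l * diffCount G (A j) (A l) d)
      ≡⟨ sym (sum-map-allFin (λ l → δ̄ j l * diffCount G (A j) (A l) d)) ⟩
    ℕL.sum (List.map (λ l → δ̄ j l * diffCount G (A j) (A l) d) (allFin m))
      ≡⟨ sym (sum-map-filter (λ l → ¬? (l ≟ j)) (λ l → diffCount G (A j) (A l) d) (allFin m)) ⟩
    ℕL.sum (List.map (λ l → diffCount G (A j) (A l) d) (filter (λ l → ¬? (l ≟ j)) (allFin m)))
      ≡⟨ balanced j d d≢0 ⟩
    lam ∎
    where open ≡-Reasoning

  C≡0-at-0 : ∀ j l → j ≢ l → C j l 0# ≡ 0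
  C≡0-at-0 j l j≢l = trans (Δ-at-0 (χ (A j)) (χ (A l))) (trans (sum-cong-≗ χχ≡0) (sum-replicate-zero n))
    where
    χχ≡0 : ∀ x → χ (A j) x * χ (A l) x ≡ 0
    χχ≡0 x with x ∈? A j | x ∈? A l
    ... | yes x∈Aj | yes x∈Al = contradiction (x , x∈p∩q⁺ (x∈Aj , x∈Al)) (disjoint j l j≢l)
    ... | yes _    | no _     = refl
    ... | no _     | _        = refl

  module _ (i : Fin m) where

    b : Fin n → ℕ
    b y = ∑[ j < m ] (δ̄ i j * χ (A j) y)

    ρ : Fin n → ℕ
    ρ = Δ (χ (A i)) b

    ρ≡∑C : ∀ g → ρ g ≡ ∑[ j < m ] (δ̄ i j * C i j g)
    ρ≡∑C = Δ-linearʳ (χ (A i)) (δ̄ i) (χ ∘ A)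

    ρ-at-0 : ρ 0# ≡ 0
    ρ-at-0 = trans (ρ≡∑C 0#) (trans (sum-cong-≗ term≡0) (sum-replicate-zero m))
      where
      term≡0 : ∀ j → δ̄ i j * C i j 0# ≡ 0
      term≡0 j with j ≟ i
      ... | yes _   = refl
      ... | no j≢i  = cong (1 *_) (C≡0-at-0 i j (j≢i ∘ sym))

    ρ≡λ : ∀ d → d ≢ 0# → ρ d ≡ lam
    ρ≡λ d d≢0 = trans (ρ≡∑C d) (∑C≡λ i d d≢0)

    ρ*ρ≡λ*ρ : ∀ g → ρ g * ρ g ≡ lam * ρ g
    ρ*ρ≡λ*ρ g with g ≟ 0#
    ... | yes refl rewrite ρ-at-0 = sym (*-zeroʳ lam)
    ... | no g≢0   = cong (_* ρ g) (ρ≡λ g g≢0)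

    ∑χ≡k : ∀ j → sum (χ (A j)) ≡ k
    ∑χ≡k j = trans (sym (∣A∣≡∑χ (A j))) (sizes j)

    ∑b≡[m∸1]*k : sum b ≡ (m ∸ 1) * k
    ∑b≡[m∸1]*k = begin
      ∑[ y < n ] ∑[ j < m ] (δ̄ i j * χ (A j) y) ≡⟨ ∑-comm (λ y j → δ̄ i j * χ (A j) y) ⟩
      ∑[ j < m ] ∑[ y < n ] (δ̄ i j * χ (A j) y) ≡⟨ sum-cong-≗ (λ j → sym (*-distribˡ-sum (δ̄ i j) (χ (A j)))) ⟩
      ∑[ j < m ] (δ̄ i j * sum (χ (A j)))       ≡⟨ sum-cong-≗ (λ j → cong (δ̄ i j *_) (∑χ≡k j)) ⟩
      ∑[ j < m ] (δ̄ i j * k)                   ≡⟨ ∑-δ̄-const i k ⟩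
      (m ∸ 1) * k ∎
      where open ≡-Reasoning

    ∑ρ≡k*[m∸1]*k : sum ρ ≡ k * ((m ∸ 1) * k)
    ∑ρ≡k*[m∸1]*k = trans (Δ-sum (χ (A i)) b) (cong₂ _*_ (∑χ≡k i) ∑b≡[m∸1]*k)

    T : Fin n → ℕ
    T = Δ b b

    ∑b≤T-at-0 : sum b ≤ T 0#
    ∑b≤T-at-0 = subst (sum b ≤_) (sym (Δ-at-0 b b)) (∑-mono-≤ (λ y → m≤m*m (b y)))
      where
      m≤m*m : ∀ a → a ≤ a * a
      m≤m*m zero    = z≤n
      m≤m*m (suc a) = m≤m*n (suc a) (suc a)

    [m∸2]*λ≤T : ∀ d → d ≢ 0# → (m ∸ 2) * lam ≤ T d
    [m∸2]*λ≤T d d≢0 = begin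
      (m ∸ 2) * lam          ≡⟨ cong (_* lam) (sym (∸-+-assoc m 1 1)) ⟩
      (m ∸ 1 ∸ 1) * lam      ≡⟨ *-distribʳ-∸ lam (m ∸ 1) 1 ⟩
      (m ∸ 1) * lam ∸ 1 * lam ≡⟨ cong ((m ∸ 1) * lam ∸_) (*-identityˡ lam) ⟩
      (m ∸ 1) * lam ∸ lam    ≤⟨ m≤n+o⇒m∸n≤o _ lam (subst ((m ∸ 1) * lam ≤_) (+-comm (T d) lam) bound) ⟩
      T d ∎
      where
      open ≤-Reasoning
      X : Fin m → ℕ
      X j = ∑[ l < m ] (δ̄ i l * C j l d)
      T≡∑X : T d ≡ ∑[ j < m ] (δ̄ i j * X j)
      T≡∑X = trans (Δ-linearˡ (δ̄ i) (χ ∘ A) b d)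
                   (sum-cong-≗ (λ j → cong (δ̄ i j *_) (Δ-linearʳ (χ (A j)) (δ̄ i) (χ ∘ A) d)))
      λ≤X+C : ∀ j → lam ≤ X j + C j i d
      λ≤X+C j = begin
        lam                          ≡⟨ sym (∑C≡λ j d d≢0) ⟩
        ∑[ l < m ] (δ̄ j l * C j l d) ≤⟨ ∑-mono-≤ (λ l → *-monoˡ-≤ (C j l d) (𝟙≤1 (¬? (l ≟ j)))) ⟩
        ∑[ l < m ] (1 * C j l d)     ≡⟨ sum-cong-≗ (λ l → *-identityˡ (C j l d)) ⟩
        ∑[ l < m ] C j l d           ≡⟨ sym (∑-split i (λ l → C j l d)) ⟩
        C j i d + X j                ≡⟨ +-comm (C j i d) (X j) ⟩
        X j + C j i d ∎
      ∑δ̄C≡λ : ∑[ j < m ] (δ̄ i j * C j i d) ≡ lam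
      ∑δ̄C≡λ = trans (sum-cong-≗ (λ j → cong (δ̄ i j *_) (Δ-swap (χ (A j)) (χ (A i)) d)))
                    (trans (sym (ρ≡∑C (- d))) (ρ≡λ (- d) (-‿≢0 d≢0)))
      bound : (m ∸ 1) * lam ≤ T d + lam
      bound = begin
        (m ∸ 1) * lam                                   ≡⟨ sym (∑-δ̄-const i lam) ⟩
        ∑[ j < m ] (δ̄ i j * lam)                        ≤⟨ ∑-mono-≤ (λ j → *-monoʳ-≤ (δ̄ i j) (λ≤X+C j)) ⟩
        ∑[ j < m ] (δ̄ i j * (X j + C j i d))            ≡⟨ sum-cong-≗ (λ j → *-distribˡ-+ (δ̄ i j) (X j) (C j i d)) ⟩
        ∑[ j < m ] (δ̄ i j * X j + δ̄ i j * C j i d)      ≡⟨ ∑-distrib-+ (λ j → δ̄ i j * X j) (λ j → δ̄ i j * C j i d) ⟩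
        ∑[ j < m ] (δ̄ i j * X j) + ∑[ j < m ] (δ̄ i j * C j i d) ≡⟨ cong₂ _+_ (sym T≡∑X) ∑δ̄C≡λ ⟩
        T d + lam ∎

    key-inequality : k * ((m ∸ 1) * k + (k ∸ 1) * ((m ∸ 2) * lam)) ≤ lam * (k * ((m ∸ 1) * k))
    key-inequality = begin
      k * ((m ∸ 1) * k + (k ∸ 1) * ((m ∸ 2) * lam))
        ≡⟨ cong₂ (λ s t → s * (t + (s ∸ 1) * ((m ∸ 2) * lam))) (sym (sizes i)) (sym ∑b≡[m∸1]*k) ⟩
      ∣ A i ∣ * (sum b + (∣ A i ∣ ∸ 1) * ((m ∸ 2) * lam))
        ≤⟨ ∑∑χχ-lower-bound (A i) (λ x x′ → T (x - x′)) diagonal off-diagonal ⟩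
      ∑[ x < n ] ∑[ x′ < n ] (χ (A i) x * (χ (A i) x′ * T (x - x′)))
        ≡⟨ sym (Δ-sq (χ (A i)) b) ⟩
      ∑[ g < n ] (ρ g * ρ g)  ≡⟨ sum-cong-≗ ρ*ρ≡λ*ρ ⟩
      ∑[ g < n ] (lam * ρ g)  ≡⟨ sym (*-distribˡ-sum lam ρ) ⟩
      lam * sum ρ             ≡⟨ cong (lam *_) ∑ρ≡k*[m∸1]*k ⟩
      lam * (k * ((m ∸ 1) * k)) ∎
      where
      open ≤-Reasoning
      diagonal : ∀ x → sum b ≤ T (x - x)
      diagonal x = subst (λ g → sum b ≤ T g) (sym (x-x≡0 x)) ∑b≤T-at-0
      off-diagonal : ∀ x x′ → x′ ≢ x → (m ∸ 2) * lam ≤ T (x - x′)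
      off-diagonal x x′ x′≢x = [m∸2]*λ≤T (x - x′) (λ x-x′≡0 → x′≢x (sym (x-y≡0⇒x≡y x-x′≡0)))

cancelˡ-*-bound : ∀ k B X lam .{{_ : NonZero k}} → k * (B + X) ≤ lam * (k * B) → X ≤ (lam ∸ 1) * B
cancelˡ-*-bound k B X lam k[B+X]≤lam[kB] = begin
  X                 ≤⟨ m+n≤o⇒m≤o∸n X (subst (_≤ lam * B) (+-comm B X) B+X≤lamB) ⟩
  lam * B ∸ B       ≡⟨ cong (lam * B ∸_) (sym (*-identityˡ B)) ⟩
  lam * B ∸ 1 * B   ≡⟨ sym (*-distribʳ-∸ B lam 1) ⟩
  (lam ∸ 1) * B ∎
  where
  open ≤-Reasoning
  B+X≤lamB : B + X ≤ lam * B
  B+X≤lamB = *-cancelˡ-≤ k (subst (k * (B + X) ≤_) (x∙yz≈y∙xz lam k B) k[B+X]≤lam[kB])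

theorem3p5 : (n m k lam : ℕ) → 2 ≤ lam → 3 ≤ m → lam Data.Nat.+ 1 ≤ k →
    (Σ (FinAbGroup n) λ G → Σ (Fin m → Subset n) λ A → IsSEDF G m k lam A) →
    lam * (k ∸ 1) * (m ∸ 2) ≤ (lam ∸ 1) * k * (m ∸ 1)
theorem3p5 n m k lam _ (s≤s _) lam+1≤k (G , A , _ , sizes , disjoint , balanced) =
  subst₂ _≤_ (reorderˡ (k ∸ 1) (m ∸ 2) lam) (reorderʳ (lam ∸ 1) (m ∸ 1) k)
    (cancelˡ-*-bound k ((m ∸ 1) * k) _ lam (key-inequality Fin.zero))
  where
  open SEDFCounting G A sizes disjoint balanced
  instance
    k≢0 : NonZero k
    k≢0 = >-nonZero (≤-trans (m≤n+m 1 lam) lam+1≤k)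
  reorderˡ : ∀ a b c → a * (b * c) ≡ c * a * b
  reorderˡ = solve-∀
  reorderʳ : ∀ a b c → a * (b * c) ≡ a * c * b
  reorderʳ = solve-∀
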